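{- For every integer $k\ge 6$, there exist infinitely many pairwise non-isomorphic $k$-graphs $(X,\mathscr{M})$ such that (1) $(X,\mathscr{M})$ is asymmetric, and (2) every sub-$k$-graph $(X',\mathscr{M}')$ of $(X,\mathscr{M})$ with $2\le |X'|<|X|$ has an involution.
   Context: A $k$-graph is a pair $(X,\mathscr{M})$ with $X$ a finite set and $\mathscr{M}\subseteq\binom{X}{k}$. An automorphism is a bijection $\phi:X\to X$ with $\{\phi(M):M\in\mathscr{M}\}=\mathscr{M}$. A $k$-graph is asymmetric if its only automorphism is the identity. An involution is a non-identity automorphism $\phi$ with $\phi\circ\phi$ equal to the identity. A sub-$k$-graph of $(X,\mathscr{M})$ is a $k$-graph $(X',\mathscr{M}')$ with $X'\subseteq X$ and $\mathscr{M}'\subseteq\mathscr{M}$ (not necessarily induced). -}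

module Defs where

open import Data.Nat using (ℕ; _≤_; _<_)
open import Data.Bool using (Bool; true)
open import Data.Product using (Σ; ∃; _×_; _,_)
open import Data.Fin using (Fin; _≟_)
open import Data.Fin.Subset using (Subset; ∣_∣; _∈_)
open import Data.Fin.Subset.Properties using (_∈?_)
open import Data.Fin.Properties using (any?)
open import Data.Fin.Permutation using (Permutation; _⟨$⟩ʳ_)
open import Data.Vec using (tabulate)
open import Function.Bundles using (_↣_; Injection)
open import Relation.Nullary using (¬_)
open import Relation.Nullary.Decidable using (⌊_⌋; _×-dec_)
open import Relation.Binary.PropositionalEquality using (_≡_; _≢_)

-- A k-graph (X, M): the vertex set X is Fin n (a finite set of size n),
-- and M ⊆ (X choose k) is given by its characteristic function on subsets.
record KGraph (k : ℕ) : Set where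
  field
    n       : ℕ
    edge    : Subset n → Bool
    uniform : ∀ S → edge S ≡ true → ∣ S ∣ ≡ k
open KGraph public

image : ∀ {m n} → (Fin m → Fin n) → Subset m → Subset n
image f S = tabulate λ j → ⌊ any? (λ i → (i ∈? S) ×-dec (f i ≟ j)) ⌋

-- An isomorphism G → H: a bijection of vertex sets mapping M_G onto M_H.
-- (Since S ↦ φ(S) is a bijection on subsets, {φ(M) : M ∈ M_G} = M_H iff
--  for all S, S ∈ M_G ⇔ φ(S) ∈ M_H.)
Iso : ∀ {k} → KGraph k → KGraph k → Set
Iso G H = Σ (Permutation (n G) (n H)) λ φ →
  ∀ S → edge H (image (φ ⟨$⟩ʳ_) S) ≡ edge G S

Automorphism : ∀ {k} → KGraph k → Set
Automorphism G = Iso G G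

IsIdentity : ∀ {k} (G : KGraph k) → Automorphism G → Set
IsIdentity G (φ , _) = ∀ i → φ ⟨$⟩ʳ i ≡ i

Asymmetric : ∀ {k} → KGraph k → Set
Asymmetric G = ∀ (a : Automorphism G) → IsIdentity G a

IsInvolution : ∀ {k} (G : KGraph k) → Automorphism G → Set
IsInvolution G (φ , _) = (¬ (∀ i → φ ⟨$⟩ʳ i ≡ i)) × (∀ i → φ ⟨$⟩ʳ (φ ⟨$⟩ʳ i) ≡ i)

HasInvolution : ∀ {k} → KGraph k → Set
HasInvolution G = ∃ λ (a : Automorphism G) → IsInvolution G a

-- H is (a relabelled copy of) a sub-k-graph of G: an injective vertex map
-- ι : X_H ↣ X_G sending every edge of H to an edge of G. The sub-k-graph is
-- (ι(X_H), {ι(S) : S ∈ M_H}), with |X'| = n H.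
SubKGraph : ∀ {k} → KGraph k → KGraph k → Set
SubKGraph H G = Σ (Fin (n H) ↣ Fin (n G)) λ ι →
  ∀ S → edge H S ≡ true → edge G (image (Injection.to ι) S) ≡ true

-- The examples are built dually. Fix ℓ = k − 3 and a path 0, 1, …, m′ whose points index the
-- edges; every vertex is determined by the set of edges through it, its pattern: a point {i}, a
-- pair {t, t + 1} of consecutive points, or a cyclic window of ℓ consecutive points, where the
-- window starting at 1 also contains both ends 0 and m′. Every point lies in 1 + 2 + ℓ = k
-- patterns (an end of the path lies on a single pair, and the marked window makes up for it), so
-- the edges are k-sets.
--
-- An automorphism permutes the edges and maps patterns onto patterns. The pairs are the only
-- two-point patterns, so it induces an automorphism of the path: the identity or the reflection.
-- The marked window rules out the reflection, and since a vertex is determined by its pattern the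
-- automorphism is trivial.
--
-- Let H be a proper sub-k-graph with at least two vertices. If H has no edges, any transposition
-- is an involution. If every edge were the image of an edge of H, H would contain every
-- vertex. Otherwise there are consecutive points t, t′ such that the edge at t is the image
-- of an edge of H and the edge at t′ is not; the point vertex at t and the pair vertex at {t, t′}
-- then lie on the same edges of H, and swapping them is an involution. Paths of different
-- lengths give different numbers of vertices, hence pairwise non-isomorphic examples.

module Submission where

open import Defs
open import Data.Nat using (ℕ; _≤_; _<_)
open import Relation.Nullary using (¬_)
open import Relation.Binary.PropositionalEquality using (_≢_)
open import Data.Product using (Σ; _×_)

import Data.Nat as ℕ
open import Data.Nat using (zero; suc; _∸_; z≤n; s≤s; s≤s⁻¹)
open import Data.Nat.Properties
  using ( ≤-refl; ≤-reflexive; ≤-trans; ≤-antisym; <-trans; <-≤-trans; ≤-<-trans; <⇒≤; <⇒≱; <⇒≢; ≰⇒>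
        ; <-cmp; n≤1+n; 1+n≰n; n≤0⇒n≡0; m≤m+n; m<m+n; m<1+n⇒m<n∨m≡n; _≤?_; _<?_
        ; +-comm; +-assoc; +-suc; +-identityʳ; +-∸-assoc; n∸n≡0; m∸n+n≡m; m+n∸n≡m
        ; +-mono-≤; +-monoˡ-≤; +-monoʳ-≤; +-mono-<; +-monoˡ-<; +-monoʳ-<
        ; +-cancelˡ-≤; +-cancelʳ-≤; +-cancelˡ-<; +-cancelʳ-<; +-commutativeSemigroup )
  renaming (suc-injective to ℕ-suc-injective)
open import Algebra.Properties.CommutativeSemigroup +-commutativeSemigroup using (x∙yz≈y∙xz)
open import Data.Bool as Bool using (Bool; true; false)
open import Data.Bool.Properties using (T-≡)
open import Data.Empty using (⊥; ⊥-elim)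
open import Data.Fin using (Fin; zero; suc; _≟_; toℕ; fromℕ<; inject₁; lower₁; opposite; _↑ˡ_; _↑ʳ_; splitAt)
open import Data.Fin.Properties
  using ( any?; all?; ¬∀⟶∃¬; injective⇒≤; toℕ<n; toℕ≤pred[n]; toℕ-injective; toℕ-fromℕ<; toℕ-inject₁
        ; toℕ-lower₁; inject₁-lower₁; opposite-prop; opposite-involutive; toℕ-↑ˡ; toℕ-↑ʳ
        ; splitAt-↑ˡ; splitAt-↑ʳ; join-splitAt )
open import Data.Fin.Permutation as Perm using (Permutation; _⟨$⟩ʳ_; _⟨$⟩ˡ_; inverseˡ; inverseʳ)
import Data.Fin.Permutation.Components as PC
open import Data.Fin.Subset using (Subset; _∈_; ∣_∣)
open import Data.Fin.Subset.Properties using (_∈?_; ⊆-antisym; anySubset?)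
open import Data.Product as Product using (∃; _,_; proj₁; proj₂)
open import Data.Sum as Sum using (_⊎_; inj₁; inj₂; [_,_]′)
open import Data.Vec using (tabulate)
open import Data.Vec.Properties using (lookup∘tabulate; []=⇒lookup; lookup⇒[]=; ≡-dec; tabulate-cong)
open import Function using (_∘_; _⇔_; mk⇔; Equivalence)
open import Function.Bundles using (Injection; Inverse; _↔_; _↣_; mk↔ₛ′)
open import Function.Definitions using (Injective)
open import Function.Properties.Equivalence using () renaming (refl to ⇔-refl; sym to ⇔-sym; trans to ⇔-trans)
open import Function.Properties.Inverse using (↔⇒↣)
open import Relation.Binary.Definitions using (Decidable; tri<; tri≈; tri>)
open import Relation.Binary.PropositionalEquality using (_≡_; refl; sym; trans; cong; cong₂; subst; module ≡-Reasoning)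
open import Relation.Nullary using (Dec; yes; no)
open import Relation.Nullary.Decidable
  using (⌊_⌋; _×-dec_; _⊎-dec_; ¬?; decidable-stable; toWitness; fromWitness; dec-true; dec-false; does-⇔; T?)

open Equivalence using (to; from)
open ≡-Reasoning

isYes≡true⇔ : ∀ {A : Set} (a? : Dec A) → ⌊ a? ⌋ ≡ true ⇔ A
isYes≡true⇔ a? = mk⇔ (toWitness ∘ from T-≡) (to T-≡ ∘ fromWitness)

true⇔true⇒≡ : ∀ {x y : Bool} → (x ≡ true ⇔ y ≡ true) → x ≡ y
true⇔true⇒≡ {x} {y} x⇔y = does-⇔ (⇔-trans T-≡ (⇔-trans x⇔y (⇔-sym T-≡))) (T? x) (T? y)

isYes-⇔ : ∀ {A B : Set} (a? : Dec A) (b? : Dec B) → A ⇔ B → ⌊ a? ⌋ ≡ ⌊ b? ⌋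
isYes-⇔ a? b? A⇔B = true⇔true⇒≡ (⇔-trans (isYes≡true⇔ a?) (⇔-trans A⇔B (⇔-sym (isYes≡true⇔ b?))))

∈-tabulate : ∀ {n} {f : Fin n → Bool} {x} → x ∈ tabulate f ⇔ f x ≡ true
∈-tabulate {f = f} {x} = mk⇔
  (λ x∈ → trans (sym (lookup∘tabulate f x)) ([]=⇒lookup x∈))
  (λ fx → lookup⇒[]= x _ (trans (lookup∘tabulate f x) fx))

∈-tabulate-dec : ∀ {n} {P : Fin n → Set} (P? : ∀ x → Dec (P x)) {x} → x ∈ tabulate (λ y → ⌊ P? y ⌋) ⇔ P x
∈-tabulate-dec P? {x} = ⇔-trans ∈-tabulate (isYes≡true⇔ (P? x))

∈-image : ∀ {m n} {f : Fin m → Fin n} {S y} → y ∈ image f S ⇔ ∃ λ x → x ∈ S × f x ≡ y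
∈-image {f = f} {S} = ∈-tabulate-dec (λ y → any? (λ x → (x ∈? S) ×-dec (f x ≟ y)))

∈-image⁺ : ∀ {m n} (f : Fin m → Fin n) {S x} → x ∈ S → f x ∈ image f S
∈-image⁺ f x∈S = from ∈-image (_ , x∈S , refl)

∈-image-injective : ∀ {m n} {f : Fin m → Fin n} → Injective _≡_ _≡_ f → ∀ {S x} → f x ∈ image f S → x ∈ S
∈-image-injective f-inj fx∈ with to ∈-image fx∈
... | _ , x′∈S , fx′≡fx = subst (_∈ _) (f-inj fx′≡fx) x′∈S

∈-image-permutation : ∀ {n} (φ : Permutation n n) {S y} → y ∈ image (φ ⟨$⟩ʳ_) S ⇔ φ ⟨$⟩ˡ y ∈ S
∈-image-permutation φ {S} = mk⇔
  (λ y∈ → let (x , x∈S , φx≡y) = to ∈-image y∈ in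
           subst (_∈ S) (trans (sym (inverseˡ φ)) (cong (φ ⟨$⟩ˡ_) φx≡y)) x∈S)
  (λ φ⁻¹y∈S → subst (_∈ image (φ ⟨$⟩ʳ_) S) (inverseʳ φ) (∈-image⁺ (φ ⟨$⟩ʳ_) φ⁻¹y∈S))

image-permutation-inverse : ∀ {n} (φ : Permutation n n) S → image (φ ⟨$⟩ʳ_) (image (φ ⟨$⟩ˡ_) S) ≡ S
image-permutation-inverse φ S = ⊆-antisym
  (λ y∈ → subst (_∈ S) (inverseʳ φ) (to (∈-image-permutation (Perm.flip φ)) (to (∈-image-permutation φ) y∈)))
  (λ y∈ → from (∈-image-permutation φ)
            (from (∈-image-permutation (Perm.flip φ)) (subst (_∈ S) (sym (inverseʳ φ)) y∈)))

-- Transpositions of twin vertices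

transpose-matchˡ : ∀ {n} (u w : Fin n) → PC.transpose u w u ≡ w
transpose-matchˡ u w rewrite dec-true (u ≟ u) refl = refl

transpose-matchʳ : ∀ {n} (u w : Fin n) → PC.transpose u w w ≡ u
transpose-matchʳ u w with w ≟ u
... | yes refl = refl
... | no _ rewrite dec-true (w ≟ w) refl = refl

transpose-mismatch : ∀ {n} {u w x : Fin n} → x ≢ u → x ≢ w → PC.transpose u w x ≡ x
transpose-mismatch {u = u} {w} {x} x≢u x≢w rewrite dec-false (x ≟ u) x≢u | dec-false (x ≟ w) x≢w = refl

transpose-involutive : ∀ {n} (u w x : Fin n) → PC.transpose u w (PC.transpose u w x) ≡ x
transpose-involutive u w x = by-cases (x ≟ u) (x ≟ w)
  where
  τ = PC.transpose u w
  by-cases : Dec (x ≡ u) → Dec (x ≡ w) → τ (τ x) ≡ x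
  by-cases (yes refl) _ = trans (cong τ (transpose-matchˡ u w)) (transpose-matchʳ u w)
  by-cases (no _) (yes refl) = trans (cong τ (transpose-matchʳ u w)) (transpose-matchˡ u w)
  by-cases (no x≢u) (no x≢w) = trans (cong τ (transpose-mismatch x≢u x≢w)) (transpose-mismatch x≢u x≢w)

∈-transpose : ∀ {n} {S : Subset n} {u w} → (u ∈ S ⇔ w ∈ S) → ∀ x → PC.transpose u w x ∈ S ⇔ x ∈ S
∈-transpose {S = S} {u} {w} u⇔w x = by-cases (x ≟ u) (x ≟ w)
  where
  moved-to : ∀ {y} → PC.transpose u w x ≡ y → (y ∈ S ⇔ x ∈ S) → PC.transpose u w x ∈ S ⇔ x ∈ S
  moved-to eq = subst (λ z → z ∈ S ⇔ x ∈ S) (sym eq)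
  by-cases : Dec (x ≡ u) → Dec (x ≡ w) → PC.transpose u w x ∈ S ⇔ x ∈ S
  by-cases (yes refl) _ = moved-to (transpose-matchˡ u w) (⇔-sym u⇔w)
  by-cases (no _) (yes refl) = moved-to (transpose-matchʳ u w) u⇔w
  by-cases (no x≢u) (no x≢w) = moved-to (transpose-mismatch x≢u x≢w) ⇔-refl

twins⇒hasInvolution : ∀ {k} (H : KGraph k) {u w : Fin (n H)} → u ≢ w →
  (∀ S → edge H S ≡ true → u ∈ S ⇔ w ∈ S) → HasInvolution H
twins⇒hasInvolution H {u} {w} u≢w twins = (τ , preserves) , moves-u , transpose-involutive u w
  where
  τ = Perm.transpose u w
  fixes : ∀ S → (u ∈ S ⇔ w ∈ S) → image (τ ⟨$⟩ʳ_) S ≡ S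
  fixes S u⇔w = ⊆-antisym
    (λ y∈ → to (∈-transpose (⇔-sym u⇔w) _) (to (∈-image-permutation τ) y∈))
    (λ y∈ → from (∈-image-permutation τ) (from (∈-transpose (⇔-sym u⇔w) _) y∈))
  involutive : ∀ S → image (τ ⟨$⟩ʳ_) (image (τ ⟨$⟩ʳ_) S) ≡ S
  involutive S = ⊆-antisym
    (λ y∈ → subst (_∈ S) (transpose-involutive w u _)
              (to (∈-image-permutation τ) (to (∈-image-permutation τ) y∈)))
    (λ y∈ → from (∈-image-permutation τ)
              (from (∈-image-permutation τ) (subst (_∈ S) (sym (transpose-involutive w u _)) y∈)))
  is-edge : ∀ {S T} → S ≡ T → edge H S ≡ true → edge H T ≡ true
  is-edge S≡T = subst (λ T → edge H T ≡ true) S≡T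
  preserves : ∀ S → edge H (image (τ ⟨$⟩ʳ_) S) ≡ edge H S
  preserves S = true⇔true⇒≡ (mk⇔
    (λ τS-edge → is-edge (trans (sym (fixes _ (twins _ τS-edge))) (involutive S)) τS-edge)
    (λ S-edge → is-edge (sym (fixes S (twins S S-edge))) S-edge))
  moves-u : ¬ (∀ x → τ ⟨$⟩ʳ x ≡ x)
  moves-u fixes-all = u≢w (trans (sym (fixes-all u)) (transpose-matchˡ u w))

edgeless⇒hasInvolution : ∀ {k} (H : KGraph k) → 2 ≤ n H → (∀ S → edge H S ≢ true) → HasInvolution H
edgeless⇒hasInvolution H 2≤n no-edges = twins⇒hasInvolution H 0≢1 (λ S S-edge → ⊥-elim (no-edges S S-edge))
  where
  0<n = ≤-trans (s≤s z≤n) 2≤n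
  0≢1 : fromℕ< 0<n ≢ fromℕ< 2≤n
  0≢1 eq with trans (sym (toℕ-fromℕ< 0<n)) (trans (cong toℕ eq) (toℕ-fromℕ< 2≤n))
  ... | ()

-- k-graphs given by incidence patterns

module Incidence {V : Set} {N m : ℕ} (enum : Fin N ↔ V) {_◃_ : V → Fin m → Set} (_◃?_ : Decidable _◃_) where

  vertexAt : Fin N → V
  vertexAt = Inverse.to enum

  indexOf : V → Fin N
  indexOf = Inverse.from enum

  vertexAt-indexOf : ∀ x → vertexAt (indexOf x) ≡ x
  vertexAt-indexOf = Inverse.strictlyInverseˡ enum

  vertexAt-injective : Injective _≡_ _≡_ vertexAt
  vertexAt-injective = Injection.injective (↔⇒↣ enum)

  block : Fin m → Subset N
  block i = tabulate (λ v → ⌊ vertexAt v ◃? i ⌋)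

  ∈-block : ∀ {v i} → v ∈ block i ⇔ vertexAt v ◃ i
  ∈-block = ∈-tabulate-dec (λ v → vertexAt v ◃? _)

  indexOf-∈-block : ∀ {x i} → indexOf x ∈ block i ⇔ x ◃ i
  indexOf-∈-block {x} {i} = subst (λ y → indexOf x ∈ block i ⇔ y ◃ i) (vertexAt-indexOf x) ∈-block

  isBlock? : ∀ S → Dec (∃ λ i → S ≡ block i)
  isBlock? S = any? (λ i → ≡-dec Bool._≟_ S (block i))

  incidenceGraph : ∀ {k} → (∀ i → ∣ block i ∣ ≡ k) → KGraph k
  incidenceGraph card = record
    { n = N
    ; edge = λ S → ⌊ isBlock? S ⌋
    ; uniform = λ S S-edge → let (i , S≡block) = to (isYes≡true⇔ (isBlock? S)) S-edge in
                              trans (cong ∣_∣ S≡block) (card i)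
    }

  PreservesPatterns : (Fin m → Fin m) → Set
  PreservesPatterns σ = ∀ x → ∃ λ y → ∀ i → y ◃ σ i ⇔ x ◃ i

  RigidPatterns : Set
  RigidPatterns = ∀ (σ : Permutation m m) → PreservesPatterns (σ ⟨$⟩ʳ_) → PreservesPatterns (σ ⟨$⟩ˡ_) →
    ∀ i → σ ⟨$⟩ʳ i ≡ i

  TwinsOn : (Fin m → Set) → V → V → Set
  TwinsOn F x y = ∀ i → F i → (x ◃ i ⇔ y ◃ i)

  HasTwinsIn : (Fin m → Set) → Set
  HasTwinsIn F = ∃ λ i → F i × ∃ λ x → ∃ λ y → x ≢ y × x ◃ i × y ◃ i × TwinsOn F x y

  module _ {k} (card : ∀ i → ∣ block i ∣ ≡ k) where

    private
      G = incidenceGraph card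

    edge⇔isBlock : ∀ {S} → edge G S ≡ true ⇔ ∃ λ i → S ≡ block i
    edge⇔isBlock {S} = isYes≡true⇔ (isBlock? S)

    inverse-automorphism : ∀ {φ : Permutation N N} → (∀ S → edge G (image (φ ⟨$⟩ʳ_) S) ≡ edge G S) →
      ∀ S → edge G (image (φ ⟨$⟩ˡ_) S) ≡ edge G S
    inverse-automorphism {φ} maps S = trans (sym (maps _)) (cong (edge G) (image-permutation-inverse φ S))

    module BlockMap (φ : Permutation N N) (maps : ∀ S → edge G (image (φ ⟨$⟩ʳ_) S) ≡ edge G S) where

      block-image : ∀ i → ∃ λ j → image (φ ⟨$⟩ʳ_) (block i) ≡ block j
      block-image i = to edge⇔isBlock (trans (maps (block i)) (from edge⇔isBlock (i , refl)))

      σ : Fin m → Fin m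
      σ i = proj₁ (block-image i)

      ◃-σ : ∀ v i → vertexAt (φ ⟨$⟩ʳ v) ◃ σ i ⇔ vertexAt v ◃ i
      ◃-σ v i = mk⇔
        (λ φv◃σi → to ∈-block (∈-image-injective (Injection.injective (↔⇒↣ φ))
                      (subst (φ ⟨$⟩ʳ v ∈_) (sym (proj₂ (block-image i))) (from ∈-block φv◃σi))))
        (λ v◃i → to ∈-block (subst (φ ⟨$⟩ʳ v ∈_) (proj₂ (block-image i))
                   (∈-image⁺ (φ ⟨$⟩ʳ_) (from ∈-block v◃i))))

      preserves : PreservesPatterns σ
      preserves x = vertexAt (φ ⟨$⟩ʳ indexOf x) , λ i →
        subst (λ y → vertexAt (φ ⟨$⟩ʳ indexOf x) ◃ σ i ⇔ y ◃ i) (vertexAt-indexOf x) (◃-σ (indexOf x) i)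

    asymmetric : Injective _≡_ _≡_ block → (∀ x y → (∀ i → x ◃ i ⇔ y ◃ i) → x ≡ y) → RigidPatterns →
      Asymmetric G
    asymmetric block-injective patterns-injective rigid (φ , maps) v =
      vertexAt-injective (patterns-injective _ _ λ i →
        subst (λ j → vertexAt (φ ⟨$⟩ʳ v) ◃ j ⇔ vertexAt v ◃ i) (σ-identity i) (Φ.◃-σ v i))
      where
      module Φ = BlockMap φ maps
      module Ψ = BlockMap (Perm.flip φ) (inverse-automorphism {φ} maps)
      cancels : ∀ (φ : Permutation N N) (σ τ : Fin m → Fin m) →
        (∀ v i → vertexAt (φ ⟨$⟩ʳ v) ◃ σ i ⇔ vertexAt v ◃ i) →
        (∀ v i → vertexAt (φ ⟨$⟩ˡ v) ◃ τ i ⇔ vertexAt v ◃ i) → ∀ i → τ (σ i) ≡ i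
      cancels φ σ τ σ-spec τ-spec i = block-injective (⊆-antisym
        (λ {v} v∈ → from ∈-block (to (σ-spec v i) (to (τ-spec (φ ⟨$⟩ʳ v) (σ i))
                      (subst (λ u → vertexAt u ◃ τ (σ i)) (sym (inverseˡ φ)) (to ∈-block v∈)))))
        (λ {v} v∈ → from ∈-block (subst (λ u → vertexAt u ◃ τ (σ i)) (inverseˡ φ)
                      (from (τ-spec (φ ⟨$⟩ʳ v) (σ i)) (from (σ-spec v i) (to ∈-block v∈))))))
      σ : Permutation m m
      σ = Perm.permutation Φ.σ Ψ.σ
            (cancels (Perm.flip φ) Ψ.σ Φ.σ Ψ.◃-σ Φ.◃-σ)
            (cancels φ Φ.σ Ψ.σ Φ.◃-σ Ψ.◃-σ)
      σ-identity : ∀ i → Φ.σ i ≡ i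
      σ-identity = rigid σ Φ.preserves Ψ.preserves

    module Embedded (H : KGraph k) (ι : Fin (n H) ↣ Fin N)
                    (ι-edges : ∀ S → edge H S ≡ true → edge G (image (Injection.to ι) S) ≡ true) where

      f : Fin (n H) → Fin N
      f = Injection.to ι

      Used : Fin m → Set
      Used i = ∃ λ S → edge H S ≡ true × image f S ≡ block i

      Used? : ∀ i → Dec (Used i)
      Used? i = anySubset? (λ S → (edge H S Bool.≟ true) ×-dec ≡-dec Bool._≟_ (image f S) (block i))

      edge-used : ∀ S → edge H S ≡ true → ∃ λ i → image f S ≡ block i
      edge-used S S-edge = to edge⇔isBlock (ι-edges S S-edge)

      ∈⇔◃ : ∀ {S i u} → image f S ≡ block i → u ∈ S ⇔ vertexAt (f u) ◃ i
      ∈⇔◃ fS≡block = mk⇔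
        (λ u∈S → to ∈-block (subst (_ ∈_) fS≡block (∈-image⁺ f u∈S)))
        (λ fu◃i → ∈-image-injective (Injection.injective ι) (subst (_ ∈_) (sym fS≡block) (from ∈-block fu◃i)))

      ◃-used⇒preimage : ∀ {i x} → Used i → x ◃ i → ∃ λ u → vertexAt (f u) ≡ x
      ◃-used⇒preimage {x = x} (S , _ , fS≡block) x◃i
        with to ∈-image (subst (_ ∈_) (sym fS≡block) (from indexOf-∈-block x◃i))
      ... | u , _ , fu≡x = u , trans (cong vertexAt fu≡x) (vertexAt-indexOf x)

      none-used⇒hasInvolution : 2 ≤ n H → ¬ ∃ Used → HasInvolution H
      none-used⇒hasInvolution 2≤n none-used = edgeless⇒hasInvolution H 2≤n λ S S-edge →
        let (i , fS≡block) = edge-used S S-edge in none-used (i , S , S-edge , fS≡block)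

      all-used⇒N≤n : (∀ x → ∃ (x ◃_)) → (∀ i → Used i) → N ≤ n H
      all-used⇒N≤n covered all-used = injective⇒≤ preimage-injective
        where
        preimage : ∀ v → ∃ λ u → vertexAt (f u) ≡ vertexAt v
        preimage v = let (i , v◃i) = covered (vertexAt v) in ◃-used⇒preimage (all-used i) v◃i
        preimage-injective : Injective _≡_ _≡_ (proj₁ ∘ preimage)
        preimage-injective {v} {w} eq = vertexAt-injective
          (trans (sym (proj₂ (preimage v))) (trans (cong (vertexAt ∘ f) eq) (proj₂ (preimage w))))

      twins-used⇒hasInvolution : HasTwinsIn Used → HasInvolution H
      twins-used⇒hasInvolution (i , Used-i , x , y , x≢y , x◃i , y◃i , x~y) = twins⇒hasInvolution H u≢w twins
        where
        u = proj₁ (◃-used⇒preimage Used-i x◃i)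
        w = proj₁ (◃-used⇒preimage Used-i y◃i)
        fu≡x = proj₂ (◃-used⇒preimage Used-i x◃i)
        fw≡y = proj₂ (◃-used⇒preimage Used-i y◃i)
        u≢w : u ≢ w
        u≢w u≡w = x≢y (trans (sym fu≡x) (trans (cong (vertexAt ∘ f) u≡w) fw≡y))
        twins : ∀ S → edge H S ≡ true → u ∈ S ⇔ w ∈ S
        twins S S-edge = let (j , fS≡block) = edge-used S S-edge in
          ⇔-trans (subst (λ z → u ∈ S ⇔ z ◃ j) fu≡x (∈⇔◃ fS≡block))
            (⇔-trans (x~y j (S , S-edge , fS≡block))
              (subst (λ z → z ◃ j ⇔ w ∈ S) fw≡y (⇔-sym (∈⇔◃ fS≡block))))

    proper-subgraph-hasInvolution : (∀ x → ∃ (x ◃_)) →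
      (∀ {F} → (∀ i → Dec (F i)) → ∃ F → ∃ (¬_ ∘ F) → HasTwinsIn F) →
      ∀ H → SubKGraph H G → 2 ≤ n H → n H < N → HasInvolution H
    proper-subgraph-hasInvolution covered has-twins H (ι , ι-edges) 2≤n n<N = by-cases (any? Used?) (all? Used?)
      where
      open Embedded H ι ι-edges
      by-cases : Dec (∃ Used) → Dec (∀ i → Used i) → HasInvolution H
      by-cases (no none-used) _ = none-used⇒hasInvolution 2≤n none-used
      by-cases (yes _) (yes all-used) = ⊥-elim (<⇒≱ n<N (all-used⇒N≤n covered all-used))
      by-cases (yes some-used) (no ¬all-used) =
        twins-used⇒hasInvolution (has-twins Used? some-used (¬∀⟶∃¬ m Used Used? ¬all-used))

-- Automorphisms of a path

first-failure : ∀ {n} {P : Fin (suc n) → Set} → (∀ i → Dec (P i)) → P zero →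
  ∀ j → ¬ P j → ∃ λ (t : Fin n) → P (inject₁ t) × ¬ P (suc t)
first-failure P? P0 zero ¬P0 = ⊥-elim (¬P0 P0)
first-failure {suc n} P? P0 (suc j) ¬Pj with P? (inject₁ j)
... | yes Pj′ = j , Pj′ , ¬Pj
... | no ¬Pj′ = let (t , Pt , ¬Pt+1) = first-failure (P? ∘ inject₁) P0 j ¬Pj′ in inject₁ t , Pt , ¬Pt+1

changes-value : ∀ {n} {P : Fin (suc n) → Set} → (∀ i → Dec (P i)) → ∃ P → ∃ (¬_ ∘ P) →
  ∃ λ (t : Fin n) → (P (inject₁ t) × ¬ P (suc t)) ⊎ (¬ P (inject₁ t) × P (suc t))
changes-value P? (i , Pi) (j , ¬Pj) with P? zero
... | yes P0 = let (t , Pt , ¬Pt+1) = first-failure P? P0 j ¬Pj in t , inj₁ (Pt , ¬Pt+1)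
... | no ¬P0 = let (t , ¬Pt , ¬¬Pt+1) = first-failure (¬? ∘ P?) ¬P0 i (λ ¬Pi → ¬Pi Pi) in
               t , inj₂ (¬Pt , decidable-stable (P? (suc t)) ¬¬Pt+1)

Adjacent : ∀ {n} → Fin n → Fin n → Set
Adjacent i j = suc (toℕ i) ≡ toℕ j ⊎ suc (toℕ j) ≡ toℕ i

PreservesAdjacency : ∀ {n} → (Fin (suc n) → Fin (suc n)) → Set
PreservesAdjacency {n} f = ∀ (t : Fin n) → Adjacent (f (inject₁ t)) (f (suc t))

adjacent-sym : ∀ {n} {i j : Fin n} → Adjacent i j → Adjacent j i
adjacent-sym = Sum.swap

adjacent-zero : ∀ {n} {i j : Fin (suc n)} → Adjacent i j → j ≡ zero → toℕ i ≡ 1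
adjacent-zero (inj₂ i≡1) refl = sym i≡1

opposite-adjacent : ∀ {n} {i j : Fin (suc n)} → Adjacent i j → Adjacent (opposite i) (opposite j)
opposite-adjacent {n} {i} {j} = Sum.swap ∘ Sum.map (flipped i j) (flipped j i)
  where
  flipped : ∀ i j → suc (toℕ i) ≡ toℕ j → suc (toℕ (opposite j)) ≡ toℕ (opposite i)
  flipped i j i+1≡j = begin
    suc (toℕ (opposite j))    ≡⟨ cong suc (opposite-prop j) ⟩
    suc (n ∸ toℕ j)           ≡⟨ cong (λ x → suc (n ∸ x)) (sym i+1≡j) ⟩
    suc (n ∸ suc (toℕ i))     ≡⟨ sym (+-∸-assoc 1 (subst (_≤ n) (sym i+1≡j) (toℕ≤pred[n] j))) ⟩
    n ∸ toℕ i                 ≡⟨ sym (opposite-prop i) ⟩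
    toℕ (opposite i)          ∎

-- By induction on t: f (t + 1) is adjacent to f t = t, and it cannot be t − 1 = f (t − 1).
path-fixes : ∀ {n} {f : Fin (suc n) → Fin (suc n)} → Injective _≡_ _≡_ f → PreservesAdjacency f →
  f zero ≡ zero → ∀ i → f i ≡ i
path-fixes {n} {f} f-inj f-adj f0≡0 i = fixes-up-to (toℕ i) i ≤-refl
  where
  fixes-up-to : ∀ x i → toℕ i ≤ x → f i ≡ i
  fixes-up-to _ zero _ = f0≡0
  fixes-up-to (suc x) (suc t) (s≤s t≤x) = from-adjacency (f-adj t)
    where
    ft≡t : f (inject₁ t) ≡ inject₁ t
    ft≡t = fixes-up-to x (inject₁ t) (subst (_≤ x) (sym (toℕ-inject₁ t)) t≤x)
    toℕ-ft≡t : toℕ (f (inject₁ t)) ≡ toℕ t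
    toℕ-ft≡t = trans (cong toℕ ft≡t) (toℕ-inject₁ t)
    from-adjacency : Adjacent (f (inject₁ t)) (f (suc t)) → f (suc t) ≡ suc t
    from-adjacency (inj₁ ft+1≡ft+1) = toℕ-injective (trans (sym ft+1≡ft+1) (cong suc toℕ-ft≡t))
    from-adjacency (inj₂ ft+1+1≡ft) = ⊥-elim (1+n≰n (≤-trans (n≤1+n _) t+2≤t))
      where
      ft+1<t : suc (toℕ (f (suc t))) ≤ toℕ t
      ft+1<t = ≤-reflexive (trans ft+1+1≡ft toℕ-ft≡t)
      ft+1-fixed : f (suc t) ≡ suc t
      ft+1-fixed = f-inj (fixes-up-to x (f (suc t)) (≤-trans (n≤1+n _) (≤-trans ft+1<t t≤x)))
      t+2≤t : suc (suc (toℕ t)) ≤ toℕ t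
      t+2≤t = subst (λ y → suc (toℕ y) ≤ toℕ t) ft+1-fixed ft+1<t

-- If σ 0 were an inner point, σ⁻¹ would send both of its neighbours to the only neighbour 1 of 0.
zero-to-endpoint : ∀ {n} (σ : Permutation (suc n) (suc n)) → PreservesAdjacency (σ ⟨$⟩ˡ_) →
  σ ⟨$⟩ʳ zero ≡ zero ⊎ toℕ (σ ⟨$⟩ʳ zero) ≡ n
zero-to-endpoint {n} σ σ⁻¹-adj with σ ⟨$⟩ʳ zero in σ0≡
... | zero = inj₁ refl
... | suc t with n ℕ.≟ toℕ (suc t)
...   | yes n≡t+1 = inj₂ (sym n≡t+1)
...   | no n≢t+1 = ⊥-elim (1+n≰n (≤-trans (n≤1+n _) (≤-reflexive (sym t≡t+2))))
  where
  u = lower₁ (suc t) n≢t+1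
  g = σ ⟨$⟩ˡ_
  g[t+1]≡0 : g (suc t) ≡ zero
  g[t+1]≡0 = trans (cong g (sym σ0≡)) (inverseˡ σ)
  g[u]≡0 : g (inject₁ u) ≡ zero
  g[u]≡0 = trans (cong g (inject₁-lower₁ (suc t) n≢t+1)) g[t+1]≡0
  t≡u+1 : inject₁ t ≡ suc u
  t≡u+1 = Injection.injective (↔⇒↣ (Perm.flip σ)) (toℕ-injective
    (trans (adjacent-zero (σ⁻¹-adj t) g[t+1]≡0) (sym (adjacent-zero (adjacent-sym (σ⁻¹-adj u)) g[u]≡0))))
  t≡t+2 : toℕ t ≡ suc (suc (toℕ t))
  t≡t+2 = begin
    toℕ t                   ≡⟨ sym (toℕ-inject₁ t) ⟩
    toℕ (inject₁ t)         ≡⟨ cong toℕ t≡u+1 ⟩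
    suc (toℕ u)             ≡⟨ cong suc (toℕ-lower₁ (suc t) n≢t+1) ⟩
    suc (suc (toℕ t))       ∎

path-automorphism : ∀ {n} (σ : Permutation (suc n) (suc n)) →
  PreservesAdjacency (σ ⟨$⟩ʳ_) → PreservesAdjacency (σ ⟨$⟩ˡ_) →
  (∀ i → σ ⟨$⟩ʳ i ≡ i) ⊎ (∀ i → σ ⟨$⟩ʳ i ≡ opposite i)
path-automorphism {n} σ σ-adj σ⁻¹-adj with zero-to-endpoint σ σ⁻¹-adj
... | inj₁ σ0≡0 = inj₁ (path-fixes (Injection.injective (↔⇒↣ σ)) σ-adj σ0≡0)
... | inj₂ σ0≡n = inj₂ λ i →
  trans (sym (opposite-involutive _)) (cong opposite (path-fixes ρ-injective ρ-adj ρ0≡0 i))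
  where
  ρ : Fin (suc n) → Fin (suc n)
  ρ = opposite ∘ (σ ⟨$⟩ʳ_)
  ρ-injective : Injective _≡_ _≡_ ρ
  ρ-injective eq = Injection.injective (↔⇒↣ σ)
    (trans (sym (opposite-involutive _)) (trans (cong opposite eq) (opposite-involutive _)))
  ρ-adj : PreservesAdjacency ρ
  ρ-adj t = opposite-adjacent (σ-adj t)
  ρ0≡0 : ρ zero ≡ zero
  ρ0≡0 = toℕ-injective (trans (opposite-prop (σ ⟨$⟩ʳ zero)) (trans (cong (n ∸_) σ0≡n) (n∸n≡0 n)))

-- Counting

∣tabulate∣-+ : ∀ a {b} (f : Fin (a ℕ.+ b) → Bool) →
  ∣ tabulate f ∣ ≡ ∣ tabulate (f ∘ (_↑ˡ b)) ∣ ℕ.+ ∣ tabulate (f ∘ (a ↑ʳ_)) ∣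
∣tabulate∣-+ zero f = refl
∣tabulate∣-+ (suc a) f with f zero
... | true = cong suc (∣tabulate∣-+ a (f ∘ suc))
... | false = ∣tabulate∣-+ a (f ∘ suc)

count : ∀ {P : ℕ → Set} → (∀ x → Dec (P x)) → ℕ → ℕ
count P? n = ∣ tabulate {n} (λ i → ⌊ P? (toℕ i) ⌋) ∣

count-cong : ∀ {P Q : ℕ → Set} (P? : ∀ x → Dec (P x)) (Q? : ∀ x → Dec (Q x)) n →
  (∀ x → x < n → P x ⇔ Q x) → count P? n ≡ count Q? n
count-cong P? Q? n P⇔Q = cong ∣_∣ (tabulate-cong λ i →
  isYes-⇔ (P? (toℕ i)) (Q? (toℕ i)) (P⇔Q (toℕ i) (toℕ<n i)))

count-∅ : ∀ {P : ℕ → Set} (P? : ∀ x → Dec (P x)) n → (∀ x → x < n → ¬ P x) → count P? n ≡ 0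
count-∅ P? zero _ = refl
count-∅ P? (suc n) none with P? 0
... | yes P0 = ⊥-elim (none 0 (s≤s z≤n) P0)
... | no _ = count-∅ (λ x → P? (suc x)) n (λ x x<n → none (suc x) (s≤s x<n))

count-+ : ∀ {P : ℕ → Set} (P? : ∀ x → Dec (P x)) a b →
  count P? (a ℕ.+ b) ≡ count P? a ℕ.+ count (λ x → P? (a ℕ.+ x)) b
count-+ P? a b = begin
  ∣ tabulate f ∣                                            ≡⟨ ∣tabulate∣-+ a f ⟩
  ∣ tabulate (f ∘ (_↑ˡ b)) ∣ ℕ.+ ∣ tabulate (f ∘ (a ↑ʳ_)) ∣  ≡⟨ cong₂ ℕ._+_
    (cong (∣_∣ {n = a}) (tabulate-cong λ i → cong (λ x → ⌊ P? x ⌋) (toℕ-↑ˡ i b)))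
    (cong (∣_∣ {n = b}) (tabulate-cong λ i → cong (λ x → ⌊ P? x ⌋) (toℕ-↑ʳ a i))) ⟩
  count P? a ℕ.+ count (λ x → P? (a ℕ.+ x)) b              ∎
  where
  f : Fin (a ℕ.+ b) → Bool
  f i = ⌊ P? (toℕ i) ⌋

count-⊎ : ∀ {P Q : ℕ → Set} (P? : ∀ x → Dec (P x)) (Q? : ∀ x → Dec (Q x)) n →
  (∀ x → x < n → ¬ (P x × Q x)) → count (λ x → P? x ⊎-dec Q? x) n ≡ count P? n ℕ.+ count Q? n
count-⊎ P? Q? zero _ = refl
count-⊎ P? Q? (suc n) disjoint
  with P? 0 | Q? 0 | count-⊎ (λ x → P? (suc x)) (λ x → Q? (suc x)) n (λ x x<n → disjoint (suc x) (s≤s x<n))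
... | yes P0 | yes Q0 | _ = ⊥-elim (disjoint 0 (s≤s z≤n) (P0 , Q0))
... | yes _ | no _ | ih = cong suc ih
... | no _ | yes _ | ih = trans (cong suc ih) (sym (+-suc _ _))
... | no _ | no _ | ih = ih

count-⊎-≤ : ∀ {P Q : ℕ → Set} (P? : ∀ x → Dec (P x)) (Q? : ∀ x → Dec (Q x)) n →
  count (λ x → P? x ⊎-dec Q? x) n ≤ count P? n ℕ.+ count Q? n
count-⊎-≤ P? Q? zero = z≤n
count-⊎-≤ P? Q? (suc n) with P? 0 | Q? 0 | count-⊎-≤ (λ x → P? (suc x)) (λ x → Q? (suc x)) n
... | yes _ | yes _ | ih = s≤s (≤-trans ih (+-monoʳ-≤ _ (n≤1+n _)))
... | yes _ | no _ | ih = s≤s ih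
... | no _ | yes _ | ih = ≤-trans (s≤s ih) (≤-reflexive (sym (+-suc _ _)))
... | no _ | no _ | ih = ih

count-mono : ∀ {P Q : ℕ → Set} (P? : ∀ x → Dec (P x)) (Q? : ∀ x → Dec (Q x)) n →
  (∀ x → x < n → P x → Q x) → count P? n ≤ count Q? n
count-mono P? Q? zero _ = z≤n
count-mono P? Q? (suc n) P⊆Q
  with P? 0 | Q? 0 | count-mono (λ x → P? (suc x)) (λ x → Q? (suc x)) n (λ x x<n → P⊆Q (suc x) (s≤s x<n))
... | yes P0 | no ¬Q0 | _ = ⊥-elim (¬Q0 (P⊆Q 0 (s≤s z≤n) P0))
... | yes _ | yes _ | ih = s≤s ih
... | no _ | yes _ | ih = ≤-trans ih (n≤1+n _)
... | no _ | no _ | ih = ih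

infix 4 _∈[_,_⟩ _∈[_,_⟩?

_∈[_,_⟩ : ℕ → ℕ → ℕ → Set
x ∈[ lo , hi ⟩ = lo ≤ x × x < hi

_∈[_,_⟩? : ∀ x lo hi → Dec (x ∈[ lo , hi ⟩)
x ∈[ lo , hi ⟩? = (lo ≤? x) ×-dec (x <? hi)

∈[]-+ˡ : ∀ k {x lo hi} → k ℕ.+ x ∈[ k ℕ.+ lo , k ℕ.+ hi ⟩ ⇔ x ∈[ lo , hi ⟩
∈[]-+ˡ k = mk⇔ (Product.map (+-cancelˡ-≤ k _ _) (+-cancelˡ-< k _ _)) (Product.map (+-monoʳ-≤ k) (+-monoʳ-< k))

∈[]-dual : ∀ {y b lo d} → lo ℕ.+ d ≡ suc y → y ∈[ b , b ℕ.+ d ⟩ ⇔ b ∈[ lo , lo ℕ.+ d ⟩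
∈[]-dual {y} {b} {lo} {d} lo+d≡y+1 = mk⇔
  (λ (b≤y , y<b+d) → +-cancelʳ-≤ d lo b (subst (_≤ b ℕ.+ d) (sym lo+d≡y+1) y<b+d)
                   , subst (b <_) (sym lo+d≡y+1) (s≤s b≤y))
  (λ (lo≤b , b<lo+d) → s≤s⁻¹ (subst (b <_) lo+d≡y+1 b<lo+d)
                     , subst (_≤ b ℕ.+ d) lo+d≡y+1 (+-monoˡ-≤ d lo≤b))

count-interval : ∀ lo d n → lo ℕ.+ d ≤ n → count (λ x → x ∈[ lo , lo ℕ.+ d ⟩?) n ≡ d
count-interval zero zero n _ = count-∅ (λ x → x ∈[ 0 , 0 ⟩?) n (λ { _ _ (_ , ()) })
count-interval zero (suc d) (suc n) (s≤s d≤n) with 0 ∈[ 0 , suc d ⟩?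
... | yes _ = cong suc (trans (count-cong (λ x → suc x ∈[ 0 , suc d ⟩?) (λ x → x ∈[ 0 , d ⟩?) n (λ _ _ → shift))
                              (count-interval zero d n d≤n))
  where
  shift : ∀ {x} → suc x ∈[ 0 , suc d ⟩ ⇔ x ∈[ 0 , d ⟩
  shift = mk⇔ (λ (_ , x<d) → z≤n , s≤s⁻¹ x<d) (λ (_ , x<d) → z≤n , s≤s x<d)
... | no 0∉ = ⊥-elim (0∉ (z≤n , s≤s z≤n))
count-interval (suc lo) d (suc n) (s≤s lo+d≤n) with 0 ∈[ suc lo , suc lo ℕ.+ d ⟩?
... | no _ = trans (count-cong (λ x → suc x ∈[ suc lo , suc lo ℕ.+ d ⟩?) (λ x → x ∈[ lo , lo ℕ.+ d ⟩?) n
                              (λ _ _ → ∈[]-+ˡ 1))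
                   (count-interval lo d n lo+d≤n)

count-≡ : ∀ {x n} → x < n → count (λ s → x ℕ.≟ s) n ≡ 1
count-≡ {x} {n} x<n = trans (count-cong (λ s → x ℕ.≟ s) (λ s → s ∈[ x , x ℕ.+ 1 ⟩?) n (λ _ _ → as-interval))
                           (count-interval x 1 n (subst (_≤ n) (+-comm 1 x) x<n))
  where
  as-interval : ∀ {s} → x ≡ s ⇔ s ∈[ x , x ℕ.+ 1 ⟩
  as-interval {s} = mk⇔ (λ { refl → ≤-refl , ≤-reflexive (+-comm 1 x) })
                        (λ (x≤s , s<x+1) → ≤-antisym x≤s (s≤s⁻¹ (subst (s <_) (+-comm x 1) s<x+1)))

count-≡-≤1 : ∀ p n → count (λ x → x ℕ.≟ p) n ≤ 1
count-≡-≤1 p n with p <? n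
... | yes p<n = ≤-reflexive
  (trans (count-cong (λ x → x ℕ.≟ p) (λ x → p ℕ.≟ x) n (λ _ _ → mk⇔ sym sym)) (count-≡ p<n))
... | no p≮n = ≤-trans (≤-reflexive (count-∅ (λ x → x ℕ.≟ p) n (λ { x x<n refl → p≮n x<n }))) z≤n

at-most-two : ∀ {P : ℕ → Set} (P? : ∀ x → Dec (P x)) n {p q} →
  (∀ x → x < n → P x → x ≡ p ⊎ x ≡ q) → count P? n ≤ 2
at-most-two P? n {p} {q} within = ≤-trans (count-mono P? (λ x → (x ℕ.≟ p) ⊎-dec (x ℕ.≟ q)) n within)
  (≤-trans (count-⊎-≤ (λ x → x ℕ.≟ p) (λ x → x ℕ.≟ q) n) (+-mono-≤ (count-≡-≤1 p n) (count-≡-≤1 q n)))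

-- The construction

module Construction (ℓ j : ℕ) (3≤ℓ : 3 ≤ ℓ) where

  -- The points of the path are 0, …, m′, and d = m′ − ℓ is the mirror image of ℓ.
  d m′ m : ℕ
  d = suc (ℓ ℕ.+ j)
  m′ = d ℕ.+ ℓ
  m = suc m′

  ℓ>0 : 0 < ℓ
  ℓ>0 = ≤-trans (s≤s z≤n) 3≤ℓ

  ℓ<d : ℓ < d
  ℓ<d = s≤s (m≤m+n ℓ j)

  d<m′ : d < m′
  d<m′ = m<m+n d ℓ>0

  ℓ<m′ : ℓ < m′
  ℓ<m′ = <-trans ℓ<d d<m′

  ℓ+1<m′ : suc ℓ < m′
  ℓ+1<m′ = ≤-<-trans ℓ<d d<m′

  ℓ<m : ℓ < m
  ℓ<m = <-trans ℓ<m′ ≤-refl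

  m≰ℓ : ∀ {y} → ¬ (m ℕ.+ y ≤ ℓ)
  m≰ℓ m+y≤ℓ = <⇒≱ ℓ<m (≤-trans (m≤m+n m _) m+y≤ℓ)

  -- x lies in the cyclic window {a, …, a + ℓ − 1} modulo m iff x or its lift m + x lies in [a, a + ℓ).
  InWindow : ℕ → ℕ → Set
  InWindow a x = x ∈[ a , a ℕ.+ ℓ ⟩ ⊎ m ℕ.+ x ∈[ a , a ℕ.+ ℓ ⟩

  Marked : ℕ → ℕ → Set
  Marked a x = a ≡ 1 × (x ≡ 0 ⊎ x ≡ m′)

  PointAt PairAt WindowAt : ℕ → ℕ → Set
  PointAt s x = x ≡ s
  PairAt t x = x ≡ t ⊎ x ≡ suc t
  WindowAt a x = InWindow a x ⊎ Marked a x

  PointAt? : ∀ s x → Dec (PointAt s x)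
  PointAt? s x = x ℕ.≟ s

  PairAt? : ∀ t x → Dec (PairAt t x)
  PairAt? t x = (x ℕ.≟ t) ⊎-dec (x ℕ.≟ suc t)

  InWindow? : ∀ a x → Dec (InWindow a x)
  InWindow? a x = (x ∈[ a , a ℕ.+ ℓ ⟩?) ⊎-dec (m ℕ.+ x ∈[ a , a ℕ.+ ℓ ⟩?)

  Marked? : ∀ a x → Dec (Marked a x)
  Marked? a x = (a ℕ.≟ 1) ×-dec ((x ℕ.≟ 0) ⊎-dec (x ℕ.≟ m′))

  WindowAt? : ∀ a x → Dec (WindowAt a x)
  WindowAt? a x = InWindow? a x ⊎-dec Marked? a x

  data Vertex : Set where
    point  : Fin m → Vertex
    pair   : Fin m′ → Vertex
    window : Fin m → Vertex

  _∋_ : Vertex → ℕ → Set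
  point s ∋ x = PointAt (toℕ s) x
  pair t ∋ x = PairAt (toℕ t) x
  window a ∋ x = WindowAt (toℕ a) x

  _∋?_ : ∀ v x → Dec (v ∋ x)
  point s ∋? x = PointAt? (toℕ s) x
  pair t ∋? x = PairAt? (toℕ t) x
  window a ∋? x = WindowAt? (toℕ a) x

  _◃_ : Vertex → Fin m → Set
  v ◃ i = v ∋ toℕ i

  _◃?_ : ∀ v i → Dec (v ◃ i)
  v ◃? i = v ∋? toℕ i

  N : ℕ
  N = m ℕ.+ (m′ ℕ.+ m)

  toVertex : Fin N → Vertex
  toVertex v = [ point , [ pair , window ]′ ∘ splitAt m′ ]′ (splitAt m v)

  fromVertex : Vertex → Fin N
  fromVertex (point s) = s ↑ˡ (m′ ℕ.+ m)
  fromVertex (pair t) = m ↑ʳ (t ↑ˡ m)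
  fromVertex (window a) = m ↑ʳ (m′ ↑ʳ a)

  toVertex-fromVertex : ∀ x → toVertex (fromVertex x) ≡ x
  toVertex-fromVertex (point s) rewrite splitAt-↑ˡ m s (m′ ℕ.+ m) = refl
  toVertex-fromVertex (pair t) rewrite splitAt-↑ʳ m (m′ ℕ.+ m) (t ↑ˡ m) | splitAt-↑ˡ m′ t m = refl
  toVertex-fromVertex (window a) rewrite splitAt-↑ʳ m (m′ ℕ.+ m) (m′ ↑ʳ a) | splitAt-↑ʳ m′ m a = refl

  fromVertex-toVertex : ∀ v → fromVertex (toVertex v) ≡ v
  fromVertex-toVertex v with splitAt m v | join-splitAt m (m′ ℕ.+ m) v
  ... | inj₁ s | eq = eq
  ... | inj₂ v′ | eq with splitAt m′ v′ | join-splitAt m′ m v′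
  ...   | inj₁ t | eq′ = trans (cong (m ↑ʳ_) eq′) eq
  ...   | inj₂ a | eq′ = trans (cong (m ↑ʳ_) eq′) eq

  enum : Fin N ↔ Vertex
  enum = mk↔ₛ′ toVertex fromVertex toVertex-fromVertex fromVertex-toVertex

  open Incidence enum _◃?_

  window-parts-disjoint : ∀ {a x} → ¬ (x ∈[ a , a ℕ.+ ℓ ⟩ × m ℕ.+ x ∈[ a , a ℕ.+ ℓ ⟩)
  window-parts-disjoint {a} {x} ((a≤x , _) , (_ , m+x<a+ℓ)) = <⇒≱ ℓ<m (<⇒≤ (+-cancelʳ-< x m ℓ
    (<-≤-trans m+x<a+ℓ (≤-trans (+-monoˡ-≤ ℓ a≤x) (≤-reflexive (+-comm x ℓ))))))

  window-size : ∀ {a} → a < m → count (λ x → InWindow? a x) m ≡ ℓ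
  window-size {a} a<m = begin
    count (λ x → InWindow? a x) m
      ≡⟨ count-⊎ (λ x → x ∈[ a , a ℕ.+ ℓ ⟩?) (λ x → m ℕ.+ x ∈[ a , a ℕ.+ ℓ ⟩?) m
                 (λ _ _ → window-parts-disjoint) ⟩
    count (λ x → x ∈[ a , a ℕ.+ ℓ ⟩?) m ℕ.+ count (λ x → m ℕ.+ x ∈[ a , a ℕ.+ ℓ ⟩?) m
      ≡⟨ sym (count-+ (λ y → y ∈[ a , a ℕ.+ ℓ ⟩?) m m) ⟩
    count (λ y → y ∈[ a , a ℕ.+ ℓ ⟩?) (m ℕ.+ m)
      ≡⟨ count-interval a ℓ (m ℕ.+ m) (+-mono-≤ (<⇒≤ a<m) (<⇒≤ ℓ<m)) ⟩
    ℓ ∎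

  window-not-within-two : ∀ {a p q} → a < m → ¬ (∀ x → x < m → WindowAt a x → x ≡ p ⊎ x ≡ q)
  window-not-within-two {a} a<m within = <⇒≱ 3≤ℓ (subst (_≤ 2) (window-size a<m)
    (at-most-two (λ x → InWindow? a x) m (λ x x<m in-window → within x x<m (inj₁ in-window))))

  not-in-window-1 : ∀ {x} → x ≡ 0 ⊎ x ≡ m′ → ¬ InWindow 1 x
  not-in-window-1 (inj₁ refl) (inj₁ (() , _))
  not-in-window-1 (inj₁ refl) (inj₂ (_ , m+0<1+ℓ)) = m≰ℓ (s≤s⁻¹ m+0<1+ℓ)
  not-in-window-1 (inj₂ refl) (inj₁ (_ , m′<1+ℓ)) = <⇒≱ ℓ<m′ (s≤s⁻¹ m′<1+ℓ)
  not-in-window-1 (inj₂ refl) (inj₂ (_ , m+m′<1+ℓ)) = m≰ℓ (s≤s⁻¹ m+m′<1+ℓ)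

  -- The windows through x correspond to the starting points b < 2m with m + x ∈ [b, b + ℓ).
  windows-through : ∀ {x} → x < m → count (λ a → InWindow? a x) m ≡ ℓ
  windows-through {x} x<m = begin
    count (λ a → InWindow? a x) m
      ≡⟨ count-⊎ direct wrapped m (λ _ _ → window-parts-disjoint) ⟩
    count direct m ℕ.+ count wrapped m
      ≡⟨ +-comm (count direct m) _ ⟩
    count wrapped m ℕ.+ count direct m
      ≡⟨ cong (count wrapped m ℕ.+_) (count-cong direct (λ a → lifted (m ℕ.+ a)) m (λ _ _ → ⇔-sym shift)) ⟩
    count lifted m ℕ.+ count (λ a → lifted (m ℕ.+ a)) m
      ≡⟨ sym (count-+ lifted m m) ⟩
    count lifted (m ℕ.+ m)
      ≡⟨ count-cong lifted (λ b → b ∈[ lo , lo ℕ.+ ℓ ⟩?) (m ℕ.+ m) (λ _ _ → ∈[]-dual lo+ℓ≡x+m+1) ⟩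
    count (λ b → b ∈[ lo , lo ℕ.+ ℓ ⟩?) (m ℕ.+ m)
      ≡⟨ count-interval lo ℓ (m ℕ.+ m) (subst (_≤ m ℕ.+ m) (sym lo+ℓ≡x+m+1) (+-monoʳ-< m x<m)) ⟩
    ℓ ∎
    where
    direct wrapped lifted : ∀ a → Dec _
    direct a = x ∈[ a , a ℕ.+ ℓ ⟩?
    wrapped a = m ℕ.+ x ∈[ a , a ℕ.+ ℓ ⟩?
    lifted b = m ℕ.+ x ∈[ b , b ℕ.+ ℓ ⟩?
    shift : ∀ {a} → m ℕ.+ x ∈[ m ℕ.+ a , m ℕ.+ a ℕ.+ ℓ ⟩ ⇔ x ∈[ a , a ℕ.+ ℓ ⟩
    shift {a} = subst (λ h → m ℕ.+ x ∈[ m ℕ.+ a , h ⟩ ⇔ x ∈[ a , a ℕ.+ ℓ ⟩)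
                      (sym (+-assoc m a ℓ)) (∈[]-+ˡ m)
    lo = suc (m ℕ.+ x) ∸ ℓ
    lo+ℓ≡x+m+1 : lo ℕ.+ ℓ ≡ suc (m ℕ.+ x)
    lo+ℓ≡x+m+1 = m∸n+n≡m (≤-trans (<⇒≤ ℓ<m) (≤-trans (m≤m+n m x) (n≤1+n _)))

  marks-through : ∀ {x} → x ≡ 0 ⊎ x ≡ m′ → count (λ a → Marked? a x) m ≡ 1
  marks-through {x} marked = trans
    (count-cong (λ a → Marked? a x) (λ a → 1 ℕ.≟ a) m
      (λ _ _ → mk⇔ (sym ∘ proj₁) (λ 1≡a → sym 1≡a , marked)))
    (count-≡ {1} {m} (s≤s (s≤s z≤n)))

  unmarked : ∀ {x} → ¬ (x ≡ 0 ⊎ x ≡ m′) → count (λ a → Marked? a x) m ≡ 0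
  unmarked {x} unmarked-x = count-∅ (λ a → Marked? a x) m (λ _ _ (_ , marked) → unmarked-x marked)

  pairs-and-marks-through : ∀ x → x < m → count (λ t → PairAt? t x) m′ ℕ.+ count (λ a → Marked? a x) m ≡ 2
  pairs-and-marks-through x x<m = trans
    (cong (ℕ._+ count (λ a → Marked? a x) m)
          (count-⊎ (λ t → x ℕ.≟ t) (λ t → x ℕ.≟ suc t) m′ (λ { _ _ (refl , ()) })))
    (by-position x (m<1+n⇒m<n∨m≡n x<m))
    where
    shifted : ∀ y → count (λ t → suc y ℕ.≟ suc t) m′ ≡ count (λ t → y ℕ.≟ t) m′
    shifted y =
      count-cong (λ t → suc y ℕ.≟ suc t) (λ t → y ℕ.≟ t) m′ (λ _ _ → mk⇔ ℕ-suc-injective (cong suc))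
    by-position : ∀ x → x < m′ ⊎ x ≡ m′ →
      count (λ t → x ℕ.≟ t) m′ ℕ.+ count (λ t → x ℕ.≟ suc t) m′ ℕ.+ count (λ a → Marked? a x) m ≡ 2
    by-position zero _ = cong₂ ℕ._+_
      (cong₂ ℕ._+_ (count-≡ {0} {m′} (s≤s z≤n)) (count-∅ (λ t → 0 ℕ.≟ suc t) m′ λ { _ _ () }))
      (marks-through (inj₁ refl))
    by-position (suc y) (inj₁ y+1<m′) = cong₂ ℕ._+_
      (cong₂ ℕ._+_ (count-≡ y+1<m′) (trans (shifted y) (count-≡ {y} (<-trans ≤-refl y+1<m′))))
      (unmarked λ { (inj₂ y+1≡m′) → <⇒≢ y+1<m′ y+1≡m′ })
    by-position (suc y) (inj₂ refl) = cong₂ ℕ._+_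
      (cong₂ ℕ._+_ (count-∅ (λ t → m′ ℕ.≟ t) m′ (λ { t t<m′ refl → <⇒≱ t<m′ ≤-refl }))
                   (trans (shifted y) (count-≡ {y} ≤-refl)))
      (marks-through (inj₂ refl))

  block-size-by-kind : ∀ i → ∣ block i ∣ ≡ count (λ s → PointAt? s (toℕ i)) m ℕ.+
    (count (λ t → PairAt? t (toℕ i)) m′ ℕ.+ count (λ a → WindowAt? a (toℕ i)) m)
  block-size-by-kind i = begin
    ∣ tabulate f ∣
      ≡⟨ ∣tabulate∣-+ m {m′ ℕ.+ m} f ⟩
    ∣ tabulate (λ (s : Fin m) → f (s ↑ˡ (m′ ℕ.+ m))) ∣ ℕ.+
      ∣ tabulate (λ (v : Fin (m′ ℕ.+ m)) → f (m ↑ʳ v)) ∣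
      ≡⟨ cong (∣ tabulate (λ (s : Fin m) → f (s ↑ˡ (m′ ℕ.+ m))) ∣ ℕ.+_)
              (∣tabulate∣-+ m′ {m} (λ v → f (m ↑ʳ v))) ⟩
    ∣ tabulate (λ (s : Fin m) → f (fromVertex (point s))) ∣ ℕ.+
      (∣ tabulate (λ (t : Fin m′) → f (fromVertex (pair t))) ∣ ℕ.+
       ∣ tabulate (λ (a : Fin m) → f (fromVertex (window a))) ∣)
      ≡⟨ cong₂ ℕ._+_ (kind point) (cong₂ ℕ._+_ (kind pair) (kind window)) ⟩
    count (λ s → PointAt? s (toℕ i)) m ℕ.+
      (count (λ t → PairAt? t (toℕ i)) m′ ℕ.+ count (λ a → WindowAt? a (toℕ i)) m)
      ∎
    where
    f : Fin N → Bool
    f v = ⌊ toVertex v ◃? i ⌋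
    kind : ∀ {n} (c : Fin n → Vertex) →
      ∣ tabulate (λ y → f (fromVertex (c y))) ∣ ≡ ∣ tabulate (λ y → ⌊ c y ◃? i ⌋) ∣
    kind c = cong ∣_∣ (tabulate-cong λ y → cong (λ u → ⌊ u ◃? i ⌋) (toVertex-fromVertex (c y)))

  block-size : ∀ i → ∣ block i ∣ ≡ 3 ℕ.+ ℓ
  block-size i = begin
    ∣ block i ∣
      ≡⟨ block-size-by-kind i ⟩
    count (λ s → PointAt? s x) m ℕ.+ (P ℕ.+ count (λ a → WindowAt? a x) m)
      ≡⟨ cong₂ ℕ._+_ (count-≡ (toℕ<n i)) (cong (P ℕ.+_) (count-⊎ (λ a → InWindow? a x) (λ a → Marked? a x) m
           (λ { _ _ (in-window , refl , marked) → not-in-window-1 marked in-window }))) ⟩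
    1 ℕ.+ (P ℕ.+ (count (λ a → InWindow? a x) m ℕ.+ M))
      ≡⟨ cong (λ w → 1 ℕ.+ (P ℕ.+ (w ℕ.+ M))) (windows-through (toℕ<n i)) ⟩
    1 ℕ.+ (P ℕ.+ (ℓ ℕ.+ M))
      ≡⟨ cong suc (x∙yz≈y∙xz P ℓ M) ⟩
    1 ℕ.+ (ℓ ℕ.+ (P ℕ.+ M))
      ≡⟨ cong (λ w → 1 ℕ.+ (ℓ ℕ.+ w)) (pairs-and-marks-through x (toℕ<n i)) ⟩
    1 ℕ.+ (ℓ ℕ.+ 2)
      ≡⟨ cong suc (+-comm ℓ 2) ⟩
    3 ℕ.+ ℓ ∎
    where
    x = toℕ i
    P = count (λ t → PairAt? t x) m′
    M = count (λ a → Marked? a x) m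

  pred-cyclic : ℕ → ℕ
  pred-cyclic zero = m′
  pred-cyclic (suc y) = y

  pred-cyclic-< : ∀ {x} → x < m → pred-cyclic x < m
  pred-cyclic-< {zero} _ = ≤-refl
  pred-cyclic-< {suc y} y+1<m = <-trans ≤-refl y+1<m

  -- A window other than window 1 starts only at a, and window 1 only at m′; this tells windows apart.
  Starts : ℕ → ℕ → Set
  Starts a x = WindowAt a x × ¬ WindowAt a (pred-cyclic x)

  window-starts-at-a : ∀ {a} → a ≢ 1 → Starts a a
  window-starts-at-a {a} a≢1 = inj₁ (inj₁ (≤-refl , m<m+n a ℓ>0)) , outside a a≢1
    where
    outside : ∀ a → a ≢ 1 → ¬ WindowAt a (pred-cyclic a)
    outside zero _ (inj₁ (inj₁ (_ , m′<ℓ))) = <⇒≱ ℓ<m′ (<⇒≤ m′<ℓ)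
    outside zero _ (inj₁ (inj₂ (_ , m+m′<ℓ))) = m≰ℓ (<⇒≤ m+m′<ℓ)
    outside (suc b) _ (inj₁ (inj₁ (b+1≤b , _))) = 1+n≰n b+1≤b
    outside (suc b) _ (inj₁ (inj₂ (_ , m+b<b+1+ℓ))) =
      <⇒≱ ℓ<m (+-cancelʳ-≤ b m ℓ (≤-trans (s≤s⁻¹ m+b<b+1+ℓ) (≤-reflexive (+-comm b ℓ))))
    outside _ a≢1 (inj₂ (a≡1 , _)) = a≢1 a≡1

  starts-unique : ∀ {a x} → a < m → a ≢ 1 → Starts a x → x ≡ a
  starts-unique _ a≢1 (inj₂ (a≡1 , _) , _) = ⊥-elim (a≢1 a≡1)
  starts-unique {a} {zero} _ _ (inj₁ (inj₁ (a≤0 , _)) , _) = sym (n≤0⇒n≡0 a≤0)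
  starts-unique {a} {zero} a<m _ (inj₁ (inj₂ (_ , m+0<a+ℓ)) , m′∉) = ⊥-elim (m′∉ (inj₁ (inj₁
    (s≤s⁻¹ a<m , <-trans (subst (m′ <_) (sym (+-identityʳ m)) ≤-refl) m+0<a+ℓ))))
  starts-unique {a} {suc y} _ _ (inj₁ (inj₁ (a≤y+1 , y+1<a+ℓ)) , y∉) with a ≤? y
  ... | yes a≤y = ⊥-elim (y∉ (inj₁ (inj₁ (a≤y , <-trans ≤-refl y+1<a+ℓ))))
  ... | no a≰y = ≤-antisym (≰⇒> a≰y) a≤y+1
  starts-unique {a} {suc y} a<m _ (inj₁ (inj₂ (_ , m+y+1<a+ℓ)) , y∉) = ⊥-elim (y∉ (inj₁ (inj₂
    (≤-trans (<⇒≤ a<m) (m≤m+n m y) , <-trans (+-monoʳ-< m ≤-refl) m+y+1<a+ℓ))))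

  starts-unique-1 : ∀ {x} → Starts 1 x → x ≡ m′
  starts-unique-1 (inj₂ (_ , inj₂ x≡m′) , _) = x≡m′
  starts-unique-1 (inj₂ (_ , inj₁ refl) , m′∉) = ⊥-elim (m′∉ (inj₂ (refl , inj₂ refl)))
  starts-unique-1 (inj₁ (inj₂ (_ , m+x<1+ℓ)) , _) = ⊥-elim (m≰ℓ (s≤s⁻¹ m+x<1+ℓ))
  starts-unique-1 {suc zero} (inj₁ (inj₁ _) , 0∉) = ⊥-elim (0∉ (inj₂ (refl , inj₁ refl)))
  starts-unique-1 {suc (suc z)} (inj₁ (inj₁ (_ , z+2<1+ℓ)) , z+1∉) =
    ⊥-elim (z+1∉ (inj₁ (inj₁ (s≤s z≤n , <-trans ≤-refl z+2<1+ℓ))))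

  ℓ-separates : WindowAt 1 ℓ × ¬ WindowAt m′ ℓ
  ℓ-separates = inj₁ (inj₁ (ℓ>0 , ≤-refl)) , outside
    where
    outside : ¬ WindowAt m′ ℓ
    outside (inj₁ (inj₁ (m′≤ℓ , _))) = <⇒≱ ℓ<m′ m′≤ℓ
    outside (inj₁ (inj₂ (_ , m+ℓ<m′+ℓ))) = 1+n≰n (+-cancelʳ-≤ ℓ m m′ (<⇒≤ m+ℓ<m′+ℓ))
    outside (inj₂ (m′≡1 , _)) = <⇒≱ ℓ+1<m′ (subst (_≤ suc ℓ) (sym m′≡1) (s≤s z≤n))

  SameWindow : ℕ → ℕ → Set
  SameWindow a a′ = ∀ x → x < m → WindowAt a x ⇔ WindowAt a′ x

  SameWindow-sym : ∀ {a a′} → SameWindow a a′ → SameWindow a′ a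
  SameWindow-sym same x x<m = ⇔-sym (same x x<m)

  starts-transfer : ∀ {a a′ x} → SameWindow a a′ → x < m → Starts a x → Starts a′ x
  starts-transfer same x<m (x∈ , pred∉) =
    to (same _ x<m) x∈ , λ pred∈ → pred∉ (from (same _ (pred-cyclic-< x<m)) pred∈)

  window≉window-1 : ∀ {a} → a < m → a ≢ 1 → ¬ SameWindow a 1
  window≉window-1 a<m a≢1 same with starts-unique-1 (starts-transfer same a<m (window-starts-at-a a≢1))
  ... | refl = proj₂ ℓ-separates (from (same ℓ ℓ<m) (proj₁ ℓ-separates))

  window-pattern-injective : ∀ {a a′} → a < m → a′ < m → SameWindow a a′ → a ≡ a′
  window-pattern-injective {a} {a′} a<m a′<m same with a ℕ.≟ 1 | a′ ℕ.≟ 1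
  ... | yes refl | yes refl = refl
  ... | no a≢1 | no a′≢1 =
    sym (starts-unique a<m a≢1 (starts-transfer (SameWindow-sym same) a′<m (window-starts-at-a a′≢1)))
  ... | no a≢1 | yes refl = ⊥-elim (window≉window-1 a<m a≢1 same)
  ... | yes refl | no a′≢1 = ⊥-elim (window≉window-1 a′<m a′≢1 (SameWindow-sym same))

  SamePattern : Vertex → Vertex → Set
  SamePattern u v = ∀ x → x < m → u ∋ x ⇔ v ∋ x

  SamePattern-sym : ∀ u v → SamePattern u v → SamePattern v u
  SamePattern-sym _ _ same x x<m = ⇔-sym (same x x<m)

  pair-first : ∀ (t : Fin m′) → toℕ t < m
  pair-first t = <-trans (toℕ<n t) ≤-refl

  point≁pair : ∀ {s t} → ¬ SamePattern (pair t) (point s)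
  point≁pair {s} {t} same = <⇒≢ ≤-refl (trans (to (same (toℕ t) (pair-first t)) (inj₁ refl))
                                              (sym (to (same (suc (toℕ t)) (s≤s (toℕ<n t))) (inj₂ refl))))

  point≁window : ∀ {s a} → ¬ SamePattern (window a) (point s)
  point≁window {s} {a} same = window-not-within-two {q = toℕ s} (toℕ<n a) (λ x x<m x∈ → inj₁ (to (same x x<m) x∈))

  pair≁window : ∀ {t a} → ¬ SamePattern (window a) (pair t)
  pair≁window {a = a} same = window-not-within-two (toℕ<n a) (λ x x<m x∈ → to (same x x<m) x∈)

  pattern-injective : ∀ u v → SamePattern u v → u ≡ v
  pattern-injective (point s) (point s′) same = cong point (toℕ-injective (to (same (toℕ s) (toℕ<n s)) refl))
  pattern-injective (pair t) (pair t′) same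
    with to (same (toℕ t) (pair-first t)) (inj₁ refl) | to (same (suc (toℕ t)) (s≤s (toℕ<n t))) (inj₂ refl)
  ... | inj₁ t≡t′ | _ = cong pair (toℕ-injective t≡t′)
  ... | _ | inj₂ t+1≡t′+1 = cong pair (toℕ-injective (ℕ-suc-injective t+1≡t′+1))
  ... | inj₂ t≡t′+1 | inj₁ t+1≡t′ =
    ⊥-elim (1+n≰n (≤-trans (n≤1+n _) (≤-reflexive (sym (trans t≡t′+1 (cong suc (sym t+1≡t′)))))))
  pattern-injective (window a) (window a′) same =
    cong window (toℕ-injective (window-pattern-injective (toℕ<n a) (toℕ<n a′) same))
  pattern-injective (point s) (pair t) same = ⊥-elim (point≁pair {s} {t} (SamePattern-sym (point s) (pair t) same))
  pattern-injective (pair t) (point s) same = ⊥-elim (point≁pair {s} {t} same)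
  pattern-injective (point s) (window a) same = ⊥-elim (point≁window {s} {a} (SamePattern-sym (point s) (window a) same))
  pattern-injective (window a) (point s) same = ⊥-elim (point≁window {s} {a} same)
  pattern-injective (pair t) (window a) same = ⊥-elim (pair≁window {t} {a} (SamePattern-sym (pair t) (window a) same))
  pattern-injective (window a) (pair t) same = ⊥-elim (pair≁window {t} {a} same)

  two-point-pattern-adjacent : ∀ u {p q} → p ≢ q → u ∋ p → u ∋ q →
    (∀ x → x < m → u ∋ x → x ≡ p ⊎ x ≡ q) → suc p ≡ q ⊎ suc q ≡ p
  two-point-pattern-adjacent (point s) p≢q p≡s q≡s _ = ⊥-elim (p≢q (trans p≡s (sym q≡s)))
  two-point-pattern-adjacent (pair t) _ (inj₁ refl) (inj₂ refl) _ = inj₁ refl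
  two-point-pattern-adjacent (pair t) _ (inj₂ refl) (inj₁ refl) _ = inj₂ refl
  two-point-pattern-adjacent (pair t) p≢q (inj₁ refl) (inj₁ refl) _ = ⊥-elim (p≢q refl)
  two-point-pattern-adjacent (pair t) p≢q (inj₂ refl) (inj₂ refl) _ = ⊥-elim (p≢q refl)
  two-point-pattern-adjacent (window a) _ _ _ within = ⊥-elim (window-not-within-two (toℕ<n a) within)

  preserves-adjacency : ∀ (σ : Permutation m m) → PreservesPatterns (σ ⟨$⟩ʳ_) → PreservesAdjacency (σ ⟨$⟩ʳ_)
  preserves-adjacency σ preserves t = two-point-pattern-adjacent y p≢q
    (from (spec (inject₁ t)) (inj₁ (toℕ-inject₁ t))) (from (spec (suc t)) (inj₂ refl)) within
    where
    y = proj₁ (preserves (pair t))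
    spec = proj₂ (preserves (pair t))
    p≢q : toℕ (σ ⟨$⟩ʳ inject₁ t) ≢ toℕ (σ ⟨$⟩ʳ suc t)
    p≢q eq = <⇒≢ ≤-refl
      (trans (sym (toℕ-inject₁ t)) (cong toℕ (Injection.injective (↔⇒↣ σ) (toℕ-injective eq))))
    within : ∀ x → x < m → y ∋ x → x ≡ toℕ (σ ⟨$⟩ʳ inject₁ t) ⊎ x ≡ toℕ (σ ⟨$⟩ʳ suc t)
    within x x<m y∋x = Sum.map (λ k≡t → image-of (inject₁ t) (trans k≡t (sym (toℕ-inject₁ t)))) (image-of (suc t))
                               (to (spec k) (subst (y ◃_) (sym (inverseʳ σ)) y◃i))
      where
      i = fromℕ< x<m
      k = σ ⟨$⟩ˡ i
      y◃i : y ◃ i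
      y◃i = subst (y ∋_) (sym (toℕ-fromℕ< x<m)) y∋x
      image-of : ∀ (l : Fin m) → toℕ k ≡ toℕ l → x ≡ toℕ (σ ⟨$⟩ʳ l)
      image-of l k≡l = trans (sym (toℕ-fromℕ< x<m))
        (cong toℕ (trans (sym (inverseʳ σ)) (cong (σ ⟨$⟩ʳ_) (toℕ-injective k≡l))))

  no-window-through-0-and-d : ∀ {a} → a < m → WindowAt a 0 → WindowAt a d → ⊥
  no-window-through-0-and-d _ (inj₁ (inj₁ (z≤n , _))) (inj₁ (inj₁ (_ , d<ℓ))) = <⇒≱ ℓ<d (<⇒≤ d<ℓ)
  no-window-through-0-and-d _ (inj₁ (inj₁ (z≤n , _))) (inj₁ (inj₂ (_ , m+d<ℓ))) = m≰ℓ (<⇒≤ m+d<ℓ)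
  no-window-through-0-and-d _ (inj₁ (inj₂ (_ , m+0<a+ℓ))) (inj₁ (inj₁ (a≤d , _))) =
    <⇒≱ (<-≤-trans m+0<a+ℓ (+-monoˡ-≤ ℓ a≤d)) (≤-trans (n≤1+n m′) (m≤m+n m 0))
  no-window-through-0-and-d a<m (inj₁ (inj₂ _)) (inj₁ (inj₂ (_ , m+d<a+ℓ))) =
    <⇒≱ ℓ<d (≤-trans (n≤1+n d) (<⇒≤ (+-cancelˡ-≤ m′ (suc (suc d)) ℓ
      (≤-trans (≤-reflexive (trans (+-suc m′ (suc d)) (cong suc (+-suc m′ d))))
               (<-≤-trans m+d<a+ℓ (+-monoˡ-≤ ℓ (s≤s⁻¹ a<m)))))))
  no-window-through-0-and-d _ (inj₁ (inj₂ (_ , m+0<1+ℓ))) (inj₂ (refl , _)) = m≰ℓ (s≤s⁻¹ m+0<1+ℓ)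
  no-window-through-0-and-d _ (inj₂ (refl , _)) (inj₁ (inj₁ (_ , d<1+ℓ))) = <⇒≱ ℓ<d (s≤s⁻¹ d<1+ℓ)
  no-window-through-0-and-d _ (inj₂ (refl , _)) (inj₁ (inj₂ (_ , m+d<1+ℓ))) = m≰ℓ (s≤s⁻¹ m+d<1+ℓ)
  no-window-through-0-and-d _ (inj₂ (refl , _)) (inj₂ (_ , inj₂ d≡m′)) = <⇒≢ d<m′ d≡m′

  no-vertex-through-0-d-m′ : ∀ u → u ∋ 0 → u ∋ d → u ∋ m′ → ⊥
  no-vertex-through-0-d-m′ (point s) 0≡s _ m′≡s with trans m′≡s (sym 0≡s)
  ... | ()
  no-vertex-through-0-d-m′ (pair t) (inj₁ 0≡t) _ (inj₁ m′≡t) with trans m′≡t (sym 0≡t)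
  ... | ()
  no-vertex-through-0-d-m′ (pair t) (inj₁ 0≡t) _ (inj₂ m′≡t+1) =
    <⇒≱ ℓ+1<m′ (≤-trans (≤-reflexive (trans m′≡t+1 (cong suc (sym 0≡t)))) (s≤s z≤n))
  no-vertex-through-0-d-m′ (window a) 0∈ d∈ _ = no-window-through-0-and-d (toℕ<n a) 0∈ d∈

  -- The reflection would carry 0, ℓ, m′ ∈ window 1 to m′, d, 0, which no vertex contains.
  not-reflection : ∀ (σ : Permutation m m) → PreservesPatterns (σ ⟨$⟩ʳ_) → ¬ (∀ i → σ ⟨$⟩ʳ i ≡ opposite i)
  not-reflection σ preserves reflection = no-vertex-through-0-d-m′ y
    (subst (y ∋_) (cong toℕ (opposite-involutive zero)) (reach (inj₂ (refl , inj₂ (opposite-prop {m} zero)))))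
    (subst (y ∋_) opposite-ℓ≡d (reach (subst (WindowAt 1) (sym (toℕ-fromℕ< ℓ<m)) (proj₁ ℓ-separates))))
    (subst (y ∋_) (opposite-prop {m} zero) (reach {zero} (inj₂ (refl , inj₁ refl))))
    where
    y = proj₁ (preserves (window (suc zero)))
    reach : ∀ {i} → window (suc zero) ◃ i → y ∋ toℕ (opposite i)
    reach {i} w = subst (y ◃_) (reflection i) (from (proj₂ (preserves (window (suc zero))) i) w)
    opposite-ℓ≡d : toℕ (opposite (fromℕ< ℓ<m)) ≡ d
    opposite-ℓ≡d = trans (opposite-prop (fromℕ< ℓ<m)) (trans (cong (m′ ∸_) (toℕ-fromℕ< ℓ<m)) (m+n∸n≡m d ℓ))

  rigid : RigidPatterns
  rigid σ σ-preserves σ⁻¹-preserves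
    with path-automorphism σ (preserves-adjacency σ σ-preserves) (preserves-adjacency (Perm.flip σ) σ⁻¹-preserves)
  ... | inj₁ identity = identity
  ... | inj₂ reflection = ⊥-elim (not-reflection σ σ-preserves reflection)

  block-injective : Injective _≡_ _≡_ block
  block-injective {i} {i′} block-i≡block-i′ = sym (toℕ-injective point-i◃i′)
    where
    point-i◃i′ : point i ◃ i′
    point-i◃i′ = to indexOf-∈-block (subst (indexOf (point i) ∈_) block-i≡block-i′ (from indexOf-∈-block refl))

  covered : ∀ x → ∃ (x ◃_)
  covered (point s) = s , refl
  covered (pair t) = inject₁ t , inj₁ (toℕ-inject₁ t)
  covered (window a) = a , inj₁ (inj₁ (≤-refl , m<m+n _ ℓ>0))

  has-twins : ∀ {F : Fin m → Set} → (∀ i → Dec (F i)) → ∃ F → ∃ (¬_ ∘ F) → HasTwinsIn F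
  has-twins {F} F? some-F some-¬F with changes-value F? some-F some-¬F
  ... | t , inj₁ (F[t] , ¬F[t+1]) =
    inject₁ t , F[t] , point (inject₁ t) , pair t , (λ ()) , refl , inj₁ (toℕ-inject₁ t) , twins
    where
    twins : TwinsOn F (point (inject₁ t)) (pair t)
    twins i Fi = mk⇔ (λ i≡t → inj₁ (trans i≡t (toℕ-inject₁ t)))
      [ (λ i≡t → trans i≡t (sym (toℕ-inject₁ t)))
      , (λ i≡t+1 → ⊥-elim (¬F[t+1] (subst F (toℕ-injective {j = suc t} i≡t+1) Fi))) ]′
  ... | t , inj₂ (¬F[t] , F[t+1]) = suc t , F[t+1] , point (suc t) , pair t , (λ ()) , refl , inj₂ refl , twins
    where
    twins : TwinsOn F (point (suc t)) (pair t)
    twins i Fi = mk⇔ inj₂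
      [ (λ i≡t → ⊥-elim (¬F[t] (subst F (toℕ-injective {j = inject₁ t} (trans i≡t (sym (toℕ-inject₁ t)))) Fi)))
      , (λ i≡t+1 → i≡t+1) ]′

  G : KGraph (3 ℕ.+ ℓ)
  G = incidenceGraph block-size

  G-asymmetric : Asymmetric G
  G-asymmetric = asymmetric block-size block-injective
    (λ u v same → pattern-injective u v λ x x<m →
       subst (λ y → u ∋ y ⇔ v ∋ y) (toℕ-fromℕ< x<m) (same (fromℕ< x<m)))
    rigid

  G-proper-subgraphs : ∀ H → SubKGraph H G → 2 ≤ n H → n H < N → HasInvolution H
  G-proper-subgraphs = proper-subgraph-hasInvolution block-size covered has-twins

vertex-count-increasing : ∀ ℓ (3≤ℓ : 3 ≤ ℓ) {i j} → i < j →
  Construction.N ℓ i 3≤ℓ < Construction.N ℓ j 3≤ℓ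
vertex-count-increasing ℓ 3≤ℓ {i} {j} i<j =
  +-mono-< (s≤s m′ᵢ<m′ⱼ) (+-mono-< m′ᵢ<m′ⱼ (s≤s m′ᵢ<m′ⱼ))
  where
  m′ᵢ<m′ⱼ : Construction.m′ ℓ i 3≤ℓ < Construction.m′ ℓ j 3≤ℓ
  m′ᵢ<m′ⱼ = s≤s (+-monoˡ-< ℓ (+-monoʳ-< ℓ i<j))

vertex-count-injective : ∀ ℓ (3≤ℓ : 3 ≤ ℓ) {i j} →
  Construction.N ℓ i 3≤ℓ ≡ Construction.N ℓ j 3≤ℓ → i ≡ j
vertex-count-injective ℓ 3≤ℓ {i} {j} Nᵢ≡Nⱼ with <-cmp i j
... | tri< i<j _ _ = ⊥-elim (<⇒≢ (vertex-count-increasing ℓ 3≤ℓ i<j) Nᵢ≡Nⱼ)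
... | tri≈ _ i≡j _ = i≡j
... | tri> _ _ j<i = ⊥-elim (<⇒≢ (vertex-count-increasing ℓ 3≤ℓ j<i) (sym Nᵢ≡Nⱼ))

theorem5 : ∀ (k : ℕ) → 6 ≤ k →
    Σ (ℕ → KGraph k) λ G →
    (∀ i j → i ≢ j → ¬ Iso (G i) (G j)) ×
    (∀ i → Asymmetric (G i) ×
    (∀ (H : KGraph k) → SubKGraph H (G i) → 2 ≤ n H → n H < n (G i) →
    HasInvolution H))
theorem5 _ (s≤s (s≤s (s≤s (s≤s (s≤s (s≤s (z≤n {c}))))))) =
  (λ j → Construction.G ℓ j 3≤ℓ) ,
  (λ i j i≢j (φ , _) → i≢j (vertex-count-injective ℓ 3≤ℓ (Perm.↔⇒≡ φ))) ,
  (λ j → Construction.G-asymmetric ℓ j 3≤ℓ , Construction.G-proper-subgraphs ℓ j 3≤ℓ)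
  where
  ℓ = 3 ℕ.+ c
  3≤ℓ : 3 ≤ ℓ
  3≤ℓ = s≤s (s≤s (s≤s z≤n))
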